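{- Let $F$ be a field, and suppose that for some positive integer $m$ we have $u_F(m)=m\,u_F(1)$. Then for every positive integer $t$, \[ u_F(t)\le \tfrac12\big( t(t-m+2)+\tau(m-\tau) \big)\, u_F(1), \] where $\tau$ is the unique integer satisfying $1\le\tau\le m$ and $\tau\equiv t \pmod m$.
   Context: For a field $F$ and a positive integer $t$, a nontrivial zero of quadratic forms $f_1,\ldots,f_t\in F[x_1,\ldots,x_n]$ is a nonzero $\mathbf a\in F^n$ with $f_j(\mathbf a)=0$ for all $1\le j\le t$. $u_F(t)$ denotes the supremum of those positive integers $n$ for which there exist $t$ quadratic forms over $F$ in $n$ variables with no nontrivial zero. -}

module Defs where

open import Level using (Level; _⊔_; suc)
open import Data.Nat as ℕ using (ℕ; zero; _≤_)
open import Data.Fin using (Fin)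
open import Data.Product using (_×_; Σ)
open import Data.Empty using (⊥)
open import Data.Unit using (⊤)
open import Relation.Nullary using (¬_)
open import Algebra.Bundles using (CommutativeRing)

record Field (c ℓ : Level) : Set (Level.suc (c ⊔ ℓ)) where
  field
    commutativeRing : CommutativeRing c ℓ
  open CommutativeRing commutativeRing public
  field
    1≉0     : ¬ (1# ≈ 0#)
    inverse : ∀ x → ¬ (x ≈ 0#) → Σ Carrier (λ y → (x * y) ≈ 1#)

module _ {c ℓ : Level} (F : Field c ℓ) where
  open Field F

  sumF : (n : ℕ) → (Fin n → Carrier) → Carrier
  sumF zero    f = 0#
  sumF (ℕ.suc n) f = f Fin.zero + sumF n (λ i → f (Fin.suc i))
    where import Data.Fin as Fin

  -- A quadratic form in n variables, given by coefficients c i j;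
  -- the form is  Σ_i Σ_j c i j x_i x_j  (every quadratic form arises this way,
  -- in any characteristic).
  QuadForm : ℕ → Set c
  QuadForm n = Fin n → Fin n → Carrier

  evalQF : {n : ℕ} → QuadForm n → (Fin n → Carrier) → Carrier
  evalQF {n} q x = sumF n (λ i → sumF n (λ j → q i j * (x i * x j)))

  NontrivialZero : {t n : ℕ} → (Fin t → QuadForm n) → (Fin n → Carrier) → Set ℓ
  NontrivialZero {t} {n} qs a =
    ¬ (∀ i → a i ≈ 0#) × (∀ j → evalQF (qs j) a ≈ 0#)

  Aniso : ℕ → ℕ → Set (c ⊔ ℓ)
  Aniso t n = Σ (Fin t → QuadForm n) (λ qs → ∀ a → ¬ NontrivialZero qs a)

data ℕ∞ : Set where
  fin : ℕ → ℕ∞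
  ∞   : ℕ∞

data _≤∞_ : ℕ∞ → ℕ∞ → Set where
  fin≤fin : ∀ {a b} → a ≤ b → fin a ≤∞ fin b
  _≤∞∞   : ∀ x → x ≤∞ ∞

-- m · e  (with 0 · ∞ = 0)
_⊗_ : ℕ → ℕ∞ → ℕ∞
m ⊗ fin u = fin (m ℕ.* u)
zero ⊗ ∞ = fin 0
ℕ.suc m ⊗ ∞ = ∞

IsSup : ∀ {p} → (ℕ → Set p) → ℕ∞ → Set p
IsSup P e = (∀ n → P n → fin n ≤∞ e) × (∀ b → (∀ n → P n → n ≤ b) → e ≤∞ fin b)

-- u_F(t) = e : e is the supremum of the positive n for which there are
-- t quadratic forms over F in n variables without nontrivial zero
IsU : ∀ {c ℓ} → Field c ℓ → ℕ → ℕ∞ → Set (c ⊔ ℓ)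
IsU F t e = IsSup (λ n → (1 ≤ n) × Aniso F t n) e

-- If every anisotropic system of s forms has at most a variables, then s forms in more
-- than a + (s+1)(d-1) variables share a totally isotropic subspace of dimension d: take a
-- common zero v with vⱼ ≠ 0, pass to the subspace {y | yⱼ = 0, y ⊥ v for all polar forms}
-- of codimension ≤ s+1, recurse, and adjoin v to the result. Restricting p further
-- forms to such a subspace of dimension u_F(p)+1 gives u_F(s+p) ≤ u_F(s) + (s+1) u_F(p).
-- Padding with anisotropic forms in u_F(1) fresh variables gives u_F(τ) ≤ τ u_F(1) from
-- u_F(m) = m u_F(1), and adding m forms at a time along t = τ + km sums to the bound.
-- Equality in F is not decidable, so the constructions live in the double-negation monad;
-- this is harmless because the conclusion is a decidable inequality between naturals.

module Submission where

open import Defs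
open import Level using (Level; _⊔_)
open import Data.Nat using (ℕ; zero; suc; _≤_; _<_; _≤?_; z≤n; s≤s)
import Data.Nat as ℕ
import Data.Nat.Properties as ℕₚ
import Data.Nat.Divisibility as ℕ∣
open import Data.Fin using (Fin; zero; suc; punchIn; splitAt; _↑ˡ_; _↑ʳ_)
open import Data.Fin.Properties using (_≟_; punchIn-injective; punchInᵢ≢i; join-splitAt)
open import Data.Vec.Functional using (Vector; _∷_; _++_)
open import Data.Vec.Functional.Properties using (lookup-++ˡ; lookup-++ʳ)
open import Data.Bool using (Bool; if_then_else_)
open import Data.Product using (Σ; _×_; _,_; proj₂; uncurry)
open import Data.Sum using (_⊎_; inj₁; inj₂; [_,_])
open import Function using (id; _∘_)
import Algebra.Properties.Semiring.Sum
open import Relation.Nullary using (¬_; yes; no; does)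
open import Relation.Nullary.Negation using (DoubleNegation; ¬¬-map; contradiction)
open import Relation.Nullary.Decidable using (decidable-stable; ¬¬-excluded-middle; dec-true; dec-false)
open import Relation.Binary.PropositionalEquality as ≡ using (_≡_; _≢_)

infixl 1 _>>=_

_>>=_ : ∀ {a b} {A : Set a} {B : Set b} →
        DoubleNegation A → (A → DoubleNegation B) → DoubleNegation B
(¬¬a >>= f) ¬b = ¬¬a (λ a → f a ¬b)

pure : ∀ {a} {A : Set a} → A → DoubleNegation A
pure a ¬a = ¬a a

↑ˡ-↑ʳ-elim : ∀ {p m n} {P : Fin (m ℕ.+ n) → Set p} →
             (∀ i → P (i ↑ˡ n)) → (∀ j → P (m ↑ʳ j)) → ∀ i → P i
↑ˡ-↑ʳ-elim {m = m} {n} {P} left right i =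
  ≡.subst P (join-splitAt m n i) ([_,_] {C = P ∘ [ _↑ˡ n , m ↑ʳ_ ]} left right (splitAt m i))

IsSup-upper : ∀ {p} {P : ℕ → Set p} {b n} → IsSup P (fin b) → P n → n ≤ b
IsSup-upper (upper , _) Pn with upper _ Pn
... | fin≤fin n≤b = n≤b

IsSup-attained : ∀ {p} {P : ℕ → Set p} {b} → IsSup P (fin (suc b)) → DoubleNegation (P (suc b))
IsSup-attained {P = P} {b} sup@(_ , least) ¬P with least b below
  where
  below : ∀ n → P n → n ≤ b
  below n Pn = ℕₚ.≤-pred (ℕₚ.≤∧≢⇒< (IsSup-upper sup Pn) (λ n≡1+b → ¬P (≡.subst P n≡1+b Pn)))
... | fin≤fin 1+b≤b = ℕₚ.<-irrefl ≡.refl 1+b≤b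

+-*-zero : ∀ a s → a ℕ.+ s ℕ.* zero ≡ a
+-*-zero a s = ≡.trans (≡.cong (a ℕ.+_) (ℕₚ.*-zeroʳ s)) (ℕₚ.+-identityʳ a)

+-*-suc : ∀ a s d → a ℕ.+ s ℕ.* suc d ≡ a ℕ.+ s ℕ.* d ℕ.+ s
+-*-suc = solve 3 (λ a s d → a :+ s :* (con 1 :+ d) := a :+ s :* d :+ s) ≡.refl
  where
  open import Data.Nat.Solver using (module +-*-Solver)
  open +-*-Solver

progressionBound : (m u τ k : ℕ) → ℕ
progressionBound m u τ zero    = τ ℕ.* u
progressionBound m u τ (suc k) = progressionBound m u τ k ℕ.+ suc (τ ℕ.+ m ℕ.* k) ℕ.* (m ℕ.* u)

module _ {c ℓ : Level} (F : Field c ℓ) where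
  open Field F hiding (zero)
  private module Sum = Algebra.Properties.Semiring.Sum semiring
  open import Algebra.Properties.Ring ring using (-‿distribʳ-*)
  open import Algebra.Solver.Ring.NaturalCoefficients.Default commutativeSemiring
    using (solve; _:=_; _:+_; _:*_)
  open import Relation.Binary.Reasoning.Setoid setoid

  private
    variable
      a b d e k l m n p s N : ℕ

  IsZero : Vector Carrier n → Set ℓ
  IsZero x = ∀ i → x i ≈ 0#

  -- Kept opaque so that unification treats summation as a rigid symbol.
  opaque
    ∑ : Vector Carrier n → Carrier
    ∑ = Sum.sum

    ∑-empty : (f : Vector Carrier 0) → ∑ f ≡ 0#
    ∑-empty f = ≡.refl

    ∑-suc : (f : Vector Carrier (suc n)) → ∑ f ≡ f zero + ∑ (f ∘ suc)
    ∑-suc f = ≡.refl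

    ∑-cong : {f g : Vector Carrier n} → (∀ i → f i ≈ g i) → ∑ f ≈ ∑ g
    ∑-cong = Sum.sum-cong-≋

    ∑-null : {f : Vector Carrier n} → IsZero f → ∑ f ≈ 0#
    ∑-null {n} f≈0 = trans (Sum.sum-cong-≋ f≈0) (Sum.sum-replicate-zero n)

    ∑-comm : (f : Fin n → Fin k → Carrier) → ∑ (λ i → ∑ (f i)) ≈ ∑ (λ j → ∑ (λ i → f i j))
    ∑-comm = Sum.∑-comm

    ∑-distrib-+ : (f g : Vector Carrier n) → ∑ (λ i → f i + g i) ≈ ∑ f + ∑ g
    ∑-distrib-+ = Sum.∑-distrib-+

    *-distribˡ-∑ : ∀ x (f : Vector Carrier n) → x * ∑ f ≈ ∑ (λ i → x * f i)
    *-distribˡ-∑ = Sum.*-distribˡ-sum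

    *-distribʳ-∑ : ∀ x (f : Vector Carrier n) → ∑ f * x ≈ ∑ (λ i → f i * x)
    *-distribʳ-∑ = Sum.*-distribʳ-sum

    sumF≡∑ : ∀ n (f : Vector Carrier n) → sumF F n f ≡ ∑ f
    sumF≡∑ zero    f = ≡.refl
    sumF≡∑ (suc n) f = ≡.cong (f zero +_) (sumF≡∑ n (f ∘ suc))

  ∑∑ : (Fin n → Fin k → Carrier) → Carrier
  ∑∑ f = ∑ (λ i → ∑ (f i))

  ∑∑-cong : {f g : Fin n → Fin k → Carrier} → (∀ i j → f i j ≈ g i j) → ∑∑ f ≈ ∑∑ g
  ∑∑-cong f≈g = ∑-cong (λ i → ∑-cong (f≈g i))

  ∑∑-distrib-+ : (f g : Fin n → Fin k → Carrier) →
                 ∑∑ (λ i j → f i j + g i j) ≈ ∑∑ f + ∑∑ g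
  ∑∑-distrib-+ f g = trans (∑-cong (λ i → ∑-distrib-+ (f i) (g i)))
                           (∑-distrib-+ (λ i → ∑ (f i)) (λ i → ∑ (g i)))

  *-distribˡ-∑∑ : ∀ x (f : Fin n → Fin k → Carrier) → x * ∑∑ f ≈ ∑∑ (λ i j → x * f i j)
  *-distribˡ-∑∑ x f = trans (*-distribˡ-∑ x (λ i → ∑ (f i))) (∑-cong (λ i → *-distribˡ-∑ x (f i)))

  *-distribʳ-∑∑ : ∀ x (f : Fin n → Fin k → Carrier) → ∑∑ f * x ≈ ∑∑ (λ i j → f i j * x)
  *-distribʳ-∑∑ x f = trans (*-distribʳ-∑ x (λ i → ∑ (f i))) (∑-cong (λ i → *-distribʳ-∑ x (f i)))

  ∑-*-∑ : (f : Vector Carrier n) (g : Vector Carrier k) →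
              ∑ f * ∑ g ≈ ∑∑ (λ i j → f i * g j)
  ∑-*-∑ f g = trans (*-distribʳ-∑ _ f) (∑-cong (λ i → *-distribˡ-∑ (f i) g))

  ∑∑-∑∑-comm : (f : Fin n → Fin k → Fin m → Fin l → Carrier) →
               ∑∑ (λ x y → ∑∑ (λ u w → f x y u w)) ≈ ∑∑ (λ u w → ∑∑ (λ x y → f x y u w))
  ∑∑-∑∑-comm f = begin
    ∑ (λ x → ∑ (λ y → ∑ (λ u → ∑ (λ w → f x y u w))))
      ≈⟨ ∑-cong (λ x → ∑-comm (λ y u → ∑ (λ w → f x y u w))) ⟩
    ∑ (λ x → ∑ (λ u → ∑ (λ y → ∑ (λ w → f x y u w))))
      ≈⟨ ∑-comm (λ x u → ∑ (λ y → ∑ (λ w → f x y u w))) ⟩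
    ∑ (λ u → ∑ (λ x → ∑ (λ y → ∑ (λ w → f x y u w))))
      ≈⟨ ∑-cong (λ u → ∑-cong (λ x → ∑-comm (λ y w → f x y u w))) ⟩
    ∑ (λ u → ∑ (λ x → ∑ (λ w → ∑ (λ y → f x y u w))))
      ≈⟨ ∑-cong (λ u → ∑-comm (λ x w → ∑ (λ y → f x y u w))) ⟩
    ∑ (λ u → ∑ (λ w → ∑ (λ x → ∑ (λ y → f x y u w)))) ∎

  Matrix : ℕ → ℕ → Set c
  Matrix n k = Fin n → Fin k → Carrier

  infixl 7 _·_ _·ᵥ_ _ᵥ·_ _·ₘ_

  _·_ : Vector Carrier n → Vector Carrier n → Carrier
  x · y = ∑ (λ i → x i * y i)

  _·ᵥ_ : Matrix n k → Vector Carrier k → Vector Carrier n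
  (M ·ᵥ z) i = M i · z

  _ᵥ·_ : Vector Carrier n → Matrix n k → Vector Carrier k
  (x ᵥ· M) j = ∑ (λ i → x i * M i j)

  _·ₘ_ : Matrix n k → Matrix k l → Matrix n l
  (M ·ₘ N) i = M i ᵥ· N

  ·-congˡ : (x : Vector Carrier n) {y z : Vector Carrier n} → (∀ i → y i ≈ z i) → x · y ≈ x · z
  ·-congˡ x y≈z = ∑-cong (λ i → *-congˡ (y≈z i))

  ᵥ·-·-assoc : (x : Vector Carrier n) (M : Matrix n k) (z : Vector Carrier k) →
               x ᵥ· M · z ≈ x · (M ·ᵥ z)
  ᵥ·-·-assoc x M z = begin
    ∑ (λ j → ∑ (λ i → x i * M i j) * z j)   ≈⟨ ∑-cong (λ j → *-distribʳ-∑ (z j) _) ⟩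
    ∑ (λ j → ∑ (λ i → x i * M i j * z j))   ≈⟨ ∑-comm _ ⟨
    ∑ (λ i → ∑ (λ j → x i * M i j * z j))   ≈⟨ ∑∑-cong (λ i j → *-assoc _ _ _) ⟩
    ∑ (λ i → ∑ (λ j → x i * (M i j * z j))) ≈⟨ ∑-cong (λ i → *-distribˡ-∑ (x i) _) ⟨
    ∑ (λ i → x i * ∑ (λ j → M i j * z j))   ∎

  ·ₘ-·ᵥ-assoc : (M : Matrix n k) (N : Matrix k l) (z : Vector Carrier l) →
                ∀ i → (M ·ₘ N ·ᵥ z) i ≈ (M ·ᵥ (N ·ᵥ z)) i
  ·ₘ-·ᵥ-assoc M N z i = ᵥ·-·-assoc (M i) N z

  TrivialKernel : Matrix n k → Set (c ⊔ ℓ)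
  TrivialKernel M = ∀ z → IsZero (M ·ᵥ z) → IsZero z

  ·ₘ-trivialKernel : {M : Matrix n k} {N : Matrix k l} →
                     TrivialKernel M → TrivialKernel N → TrivialKernel (M ·ₘ N)
  ·ₘ-trivialKernel {M = M} {N} M-inj N-inj z MNz≈0 =
    N-inj z (M-inj (N ·ᵥ z) (λ i → trans (sym (·ₘ-·ᵥ-assoc M N z i)) (MNz≈0 i)))

  indicator : Bool → Carrier
  indicator b = if b then 1# else 0#

  δ : Matrix n n
  δ i j = indicator (does (i ≟ j))

  δ-refl : (i : Fin n) → δ i i ≡ 1#
  δ-refl i = ≡.cong indicator (dec-true (i ≟ i) ≡.refl)

  δ-≢ : {i j : Fin n} → i ≢ j → δ i j ≡ 0#
  δ-≢ {i = i} {j} i≢j = ≡.cong indicator (dec-false (i ≟ j) i≢j)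

  δ-sym : (i j : Fin n) → δ i j ≡ δ j i
  δ-sym zero    zero    = ≡.refl
  δ-sym zero    (suc j) = ≡.refl
  δ-sym (suc i) zero    = ≡.refl
  δ-sym (suc i) (suc j) = δ-sym i j

  δ-punchIn : (p : Fin (suc n)) (i j : Fin n) → δ (punchIn p i) (punchIn p j) ≡ δ i j
  δ-punchIn p i j with i ≟ j
  ... | yes ≡.refl = δ-refl (punchIn p i)
  ... | no  i≢j    = δ-≢ (i≢j ∘ punchIn-injective p i j)

  δ-· : (i : Fin n) (x : Vector Carrier n) → δ i · x ≈ x i
  δ-· {suc n} zero x = begin
    δ zero · x                               ≡⟨ ∑-suc _ ⟩
    1# * x zero + ∑ (λ j → 0# * x (suc j)) ≈⟨ +-cong (*-identityˡ _) (∑-null (λ j → zeroˡ _)) ⟩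
    x zero + 0#                              ≈⟨ +-identityʳ _ ⟩
    x zero                                   ∎
  δ-· {suc n} (suc i) x = begin
    δ (suc i) · x                 ≡⟨ ∑-suc _ ⟩
    0# * x zero + δ i · (x ∘ suc) ≈⟨ +-cong (zeroˡ _) (δ-· i (x ∘ suc)) ⟩
    0# + x (suc i)                ≈⟨ +-identityˡ _ ⟩
    x (suc i)                     ∎

  ᵥ·-δ : (x : Vector Carrier n) (i : Fin n) → (x ᵥ· δ) i ≈ x i
  ᵥ·-δ x i = trans (∑-cong λ j → trans (*-comm _ _) (reflexive (≡.cong (_* x j) (δ-sym j i))))
                   (δ-· i x)

  select : (Fin k → Fin n) → Matrix k n
  select σ i = δ (σ i)

  select-·ᵥ : (σ : Fin k → Fin n) (x : Vector Carrier n) → ∀ i → (select σ ·ᵥ x) i ≈ x (σ i)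
  select-·ᵥ σ x i = δ-· (σ i) x

  select-id-trivialKernel : TrivialKernel (select {n} id)
  select-id-trivialKernel z z≈0 i = trans (sym (select-·ᵥ id z i)) (z≈0 i)

  x≉0∧x*y≈0⇒y≈0 : {x y : Carrier} → ¬ x ≈ 0# → x * y ≈ 0# → y ≈ 0#
  x≉0∧x*y≈0⇒y≈0 {x} {y} x≉0 xy≈0 with inverse x x≉0
  ... | x⁻¹ , xx⁻¹≈1 = begin
    y              ≈⟨ *-identityˡ y ⟨
    1# * y         ≈⟨ *-congʳ (trans (sym xx⁻¹≈1) (*-comm x x⁻¹)) ⟩
    x⁻¹ * x * y    ≈⟨ *-assoc x⁻¹ x y ⟩
    x⁻¹ * (x * y)  ≈⟨ *-congˡ xy≈0 ⟩
    x⁻¹ * 0#       ≈⟨ zeroʳ x⁻¹ ⟩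
    0#             ∎

  ¬¬-IsZero⊎nonzero : (x : Vector Carrier n) →
                      DoubleNegation (IsZero x ⊎ Σ (Fin n) λ i → ¬ x i ≈ 0#)
  ¬¬-IsZero⊎nonzero {zero}  x = pure (inj₁ λ ())
  ¬¬-IsZero⊎nonzero {suc n} x = do
    yes x₀≈0 ← ¬¬-excluded-middle {A = x zero ≈ 0#}
      where no x₀≉0 → pure (inj₂ (zero , x₀≉0))
    inj₁ tail≈0 ← ¬¬-IsZero⊎nonzero (x ∘ suc)
      where inj₂ (i , xᵢ≉0) → pure (inj₂ (suc i , xᵢ≉0))
    pure (inj₁ λ { zero → x₀≈0 ; (suc i) → tail≈0 i })

  record SolutionSpace (cs : Fin e → Vector Carrier N) : Set (c ⊔ ℓ) where
    field
      dim             : ℕ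
      N≤dim+e         : N ≤ dim ℕ.+ e
      embed           : Matrix N dim
      embed-injective : TrivialKernel embed
      embed-solves    : ∀ r z → cs r · (embed ·ᵥ z) ≈ 0#

  open SolutionSpace

  solutionSpace-null : (cs : Fin e → Vector Carrier N) → (∀ r → IsZero (cs r)) → SolutionSpace cs
  solutionSpace-null {e} {N} cs cs≈0 = record
    { dim             = N
    ; N≤dim+e         = ℕₚ.m≤m+n N e
    ; embed           = select id
    ; embed-injective = select-id-trivialKernel
    ; embed-solves    = λ r z → ∑-null (λ i → trans (*-congʳ (cs≈0 r i)) (zeroˡ _))
    }

  -- Solving x · y = 0 for the pivot coordinate y_p = - Σ_{i ≠ p} (x_i / x_p) y_i.
  solutionSpace-pivot : (x : Vector Carrier N) (p : Fin N) → ¬ x p ≈ 0# →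
                        SolutionSpace {e = 1} (λ _ → x)
  solutionSpace-pivot {suc n} x p xₚ≉0 with inverse (x p) xₚ≉0
  ... | xₚ⁻¹ , xₚxₚ⁻¹≈1 = record
    { dim             = n
    ; N≤dim+e         = ℕₚ.≤-reflexive (ℕₚ.+-comm 1 n)
    ; embed           = embed′
    ; embed-injective = injective
    ; embed-solves    = λ _ z → trans (sym (ᵥ·-·-assoc x embed′ z))
                                        (∑-null (λ k → trans (*-congʳ (x-kills k)) (zeroˡ _)))
    }
    where
    coefficient : Vector Carrier n
    coefficient k = - (x (punchIn p k) * xₚ⁻¹)

    embed′ : Matrix (suc n) n
    embed′ i k = δ i (punchIn p k) + δ i p * coefficient k

    x-kills : ∀ k → (x ᵥ· embed′) k ≈ 0#
    x-kills k = begin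
      ∑ (λ i → x i * (δ i (punchIn p k) + δ i p * coefficient k))
        ≈⟨ ∑-cong (λ i → trans (distribˡ _ _ _) (+-congˡ (sym (*-assoc _ _ _)))) ⟩
      ∑ (λ i → x i * δ i (punchIn p k) + x i * δ i p * coefficient k)
        ≈⟨ ∑-distrib-+ _ _ ⟩
      (x ᵥ· δ) (punchIn p k) + ∑ (λ i → x i * δ i p * coefficient k)
        ≈⟨ +-cong (ᵥ·-δ x _) (trans (sym (*-distribʳ-∑ _ _)) (*-congʳ (ᵥ·-δ x p))) ⟩
      x (punchIn p k) + x p * - (x (punchIn p k) * xₚ⁻¹)
        ≈⟨ +-congˡ (sym (-‿distribʳ-* _ _)) ⟩
      x (punchIn p k) + - (x p * (x (punchIn p k) * xₚ⁻¹))
        ≈⟨ +-congˡ (-‿cong (*-pivot _)) ⟩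
      x (punchIn p k) + - x (punchIn p k)
        ≈⟨ -‿inverseʳ _ ⟩
      0# ∎
      where
      *-pivot : ∀ y → x p * (y * xₚ⁻¹) ≈ y
      *-pivot y = begin
        x p * (y * xₚ⁻¹) ≈⟨ *-congˡ (*-comm y xₚ⁻¹) ⟩
        x p * (xₚ⁻¹ * y) ≈⟨ *-assoc _ _ _ ⟨
        x p * xₚ⁻¹ * y   ≈⟨ *-congʳ xₚxₚ⁻¹≈1 ⟩
        1# * y           ≈⟨ *-identityˡ y ⟩
        y                ∎

    embed-punchIn : ∀ z k → (embed′ ·ᵥ z) (punchIn p k) ≈ z k
    embed-punchIn z k = begin
      ∑ (λ l → (δ (punchIn p k) (punchIn p l) + δ (punchIn p k) p * coefficient l) * z l)
        ≈⟨ ∑-cong (λ l → *-congʳ (begin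
             δ (punchIn p k) (punchIn p l) + δ (punchIn p k) p * coefficient l
               ≡⟨ ≡.cong₂ (λ a b → a + b * coefficient l) (δ-punchIn p k l) (δ-≢ (punchInᵢ≢i p k)) ⟩
             δ k l + 0# * coefficient l
               ≈⟨ trans (+-congˡ (zeroˡ _)) (+-identityʳ _) ⟩
             δ k l ∎)) ⟩
      δ k · z ≈⟨ δ-· k z ⟩
      z k ∎

    injective : TrivialKernel embed′
    injective z embed-z≈0 k = trans (sym (embed-punchIn z k)) (embed-z≈0 (punchIn p k))

  ¬¬-solutionSpace₁ : (x : Vector Carrier N) → DoubleNegation (SolutionSpace {e = 1} (λ _ → x))
  ¬¬-solutionSpace₁ x = ¬¬-map [ (λ x≈0 → solutionSpace-null _ (λ _ → x≈0))
                                 , uncurry (solutionSpace-pivot x) ]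
                               (¬¬-IsZero⊎nonzero x)

  solutionSpace-∷ : {cs : Fin (suc e) → Vector Carrier N} (S : SolutionSpace (λ _ → cs zero)) →
                    SolutionSpace (λ r → cs (suc r) ᵥ· embed S) → SolutionSpace cs
  solutionSpace-∷ {e} {N} {cs} S T = record
    { dim             = dim T
    ; N≤dim+e         = N≤dim+1+e
    ; embed           = embed S ·ₘ embed T
    ; embed-injective = ·ₘ-trivialKernel (embed-injective S) (embed-injective T)
    ; embed-solves    = solves
    }
    where
    N≤dim+1+e : N ≤ dim T ℕ.+ suc e
    N≤dim+1+e = ℕₚ.≤-trans (N≤dim+e S) (ℕₚ.≤-trans (ℕₚ.+-monoˡ-≤ 1 (N≤dim+e T)) (ℕₚ.≤-reflexive
                  (≡.trans (ℕₚ.+-assoc (dim T) e 1) (≡.cong (dim T ℕ.+_) (ℕₚ.+-comm e 1)))))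

    solves : ∀ r z → cs r · (embed S ·ₘ embed T ·ᵥ z) ≈ 0#
    solves r z = trans (·-congˡ (cs r) (·ₘ-·ᵥ-assoc (embed S) (embed T) z)) (solves′ r)
      where
      solves′ : ∀ r → cs r · (embed S ·ᵥ (embed T ·ᵥ z)) ≈ 0#
      solves′ zero    = embed-solves S zero (embed T ·ᵥ z)
      solves′ (suc r) = trans (sym (ᵥ·-·-assoc (cs (suc r)) (embed S) _)) (embed-solves T r z)

  ¬¬-solutionSpace : (cs : Fin e → Vector Carrier N) → DoubleNegation (SolutionSpace cs)
  ¬¬-solutionSpace {zero}  cs = pure (solutionSpace-null cs λ ())
  ¬¬-solutionSpace {suc e} cs = do
    S ← ¬¬-solutionSpace₁ (cs zero)
    T ← ¬¬-solutionSpace (λ r → cs (suc r) ᵥ· embed S)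
    pure (solutionSpace-∷ S T)

  ⟦_⟧ : QuadForm F n → Vector Carrier n → Carrier
  ⟦ q ⟧ x = ∑∑ (λ i j → q i j * (x i * x j))

  evalQF≈⟦⟧ : (q : QuadForm F n) (x : Vector Carrier n) → evalQF F q x ≈ ⟦ q ⟧ x
  evalQF≈⟦⟧ {n} q x = trans (reflexive (sumF≡∑ n _)) (∑-cong (λ i → reflexive (sumF≡∑ n _)))

  ⟦⟧-cong : (q : QuadForm F n) {x y : Vector Carrier n} → (∀ i → x i ≈ y i) → ⟦ q ⟧ x ≈ ⟦ q ⟧ y
  ⟦⟧-cong q x≈y = ∑∑-cong (λ i j → *-congˡ (*-cong (x≈y i) (x≈y j)))

  pullback : QuadForm F n → Matrix n k → QuadForm F k
  pullback q M a b = ∑∑ (λ i j → q i j * (M i a * M j b))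

  ⟦pullback⟧ : (q : QuadForm F n) (M : Matrix n k) (z : Vector Carrier k) →
               ⟦ pullback q M ⟧ z ≈ ⟦ q ⟧ (M ·ᵥ z)
  ⟦pullback⟧ q M z = begin
    ∑∑ (λ a b → ∑∑ (λ i j → q i j * (M i a * M j b)) * (z a * z b))
      ≈⟨ ∑∑-cong (λ a b → *-distribʳ-∑∑ _ _) ⟩
    ∑∑ (λ a b → ∑∑ (λ i j → q i j * (M i a * M j b) * (z a * z b)))
      ≈⟨ ∑∑-∑∑-comm _ ⟩
    ∑∑ (λ i j → ∑∑ (λ a b → q i j * (M i a * M j b) * (z a * z b)))
      ≈⟨ ∑∑-cong (λ i j → ∑∑-cong (λ a b → regroup (q i j) (M i a) (M j b) (z a) (z b))) ⟩
    ∑∑ (λ i j → ∑∑ (λ a b → q i j * (M i a * z a * (M j b * z b))))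
      ≈⟨ ∑∑-cong (λ i j → *-distribˡ-∑∑ (q i j) _) ⟨
    ∑∑ (λ i j → q i j * ∑∑ (λ a b → M i a * z a * (M j b * z b)))
      ≈⟨ ∑∑-cong (λ i j → *-congˡ (∑-*-∑ _ _)) ⟨
    ⟦ q ⟧ (M ·ᵥ z) ∎
    where
    regroup : ∀ q a b x y → q * (a * b) * (x * y) ≈ q * (a * x * (b * y))
    regroup = solve 5 (λ q a b x y → (q :* (a :* b)) :* (x :* y) := q :* ((a :* x) :* (b :* y))) refl

  polar : QuadForm F n → Vector Carrier n → Vector Carrier n
  polar q v k = ∑ (λ i → q i k * v i) + ∑ (λ i → q k i * v i)

  polar-· : (q : QuadForm F n) (v y : Vector Carrier n) →
            polar q v · y ≈ ∑∑ (λ i j → q i j * (v i * y j + y i * v j))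
  polar-· q v y = begin
    ∑ (λ k → (∑ (λ i → q i k * v i) + ∑ (λ i → q k i * v i)) * y k)
      ≈⟨ ∑-cong (λ k → distribʳ _ _ _) ⟩
    ∑ (λ k → ∑ (λ i → q i k * v i) * y k + ∑ (λ i → q k i * v i) * y k)
      ≈⟨ ∑-distrib-+ _ _ ⟩
    ∑ (λ k → ∑ (λ i → q i k * v i) * y k) + ∑ (λ k → ∑ (λ i → q k i * v i) * y k)
      ≈⟨ +-cong (trans (∑-cong (λ k → *-distribʳ-∑ _ _)) (∑-comm _)) (∑-cong (λ k → *-distribʳ-∑ _ _)) ⟩
    ∑∑ (λ i k → q i k * v i * y k) + ∑∑ (λ k i → q k i * v i * y k)
      ≈⟨ +-cong (∑∑-cong (λ i k → *-assoc _ _ _)) (∑∑-cong (λ k i → swap (q k i) (v i) (y k))) ⟩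
    ∑∑ (λ i j → q i j * (v i * y j)) + ∑∑ (λ i j → q i j * (y i * v j))
      ≈⟨ ∑∑-distrib-+ _ _ ⟨
    ∑∑ (λ i j → q i j * (v i * y j) + q i j * (y i * v j))
      ≈⟨ ∑∑-cong (λ i j → distribˡ _ _ _) ⟨
    ∑∑ (λ i j → q i j * (v i * y j + y i * v j)) ∎
    where
    swap : ∀ q v y → q * v * y ≈ q * (y * v)
    swap = solve 3 (λ q v y → (q :* v) :* y := q :* (y :* v)) refl

  ⟦⟧-expand : (q : QuadForm F n) (t : Carrier) (v y : Vector Carrier n) →
              ⟦ q ⟧ (λ i → t * v i + y i) ≈ t * t * ⟦ q ⟧ v + t * (polar q v · y) + ⟦ q ⟧ y
  ⟦⟧-expand q t v y = begin
    ∑∑ (λ i j → q i j * ((t * v i + y i) * (t * v j + y j)))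
      ≈⟨ ∑∑-cong (λ i j → expand (q i j) t (v i) (v j) (y i) (y j)) ⟩
    ∑∑ (λ i j → t * t * (q i j * (v i * v j)) + t * (q i j * (v i * y j + y i * v j)) + q i j * (y i * y j))
      ≈⟨ trans (∑∑-distrib-+ _ _) (+-congʳ (∑∑-distrib-+ _ _)) ⟩
    ∑∑ (λ i j → t * t * (q i j * (v i * v j))) + ∑∑ (λ i j → t * (q i j * (v i * y j + y i * v j))) + ⟦ q ⟧ y
      ≈⟨ +-congʳ (+-cong (*-distribˡ-∑∑ _ _) (trans (*-congˡ (polar-· q v y)) (*-distribˡ-∑∑ _ _))) ⟨
    t * t * ⟦ q ⟧ v + t * (polar q v · y) + ⟦ q ⟧ y ∎
    where
    expand : ∀ q t a b x y → q * ((t * a + x) * (t * b + y)) ≈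
                              t * t * (q * (a * b)) + t * (q * (a * y + x * b)) + q * (x * y)
    expand = solve 6 (λ q t a b x y → q :* ((t :* a :+ x) :* (t :* b :+ y)) :=
                        t :* t :* (q :* (a :* b)) :+ t :* (q :* (a :* y :+ x :* b)) :+ q :* (x :* y)) refl

  ⟦⟧-null : (q : QuadForm F n) {x : Vector Carrier n} → IsZero x → ⟦ q ⟧ x ≈ 0#
  ⟦⟧-null q x≈0 = ∑-null (λ i → ∑-null (λ j → trans (*-congˡ (trans (*-congʳ (x≈0 i)) (zeroˡ _))) (zeroʳ _)))

  AnisoBound : ℕ → ℕ → Set (c ⊔ ℓ)
  AnisoBound s a = ∀ n → Aniso F s n → n ≤ a

  TotallyIsotropic : (Fin s → QuadForm F N) → Matrix N d → Set (c ⊔ ℓ)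
  TotallyIsotropic Q M = ∀ r z → ⟦ Q r ⟧ (M ·ᵥ z) ≈ 0#

  ¬¬-nontrivialZero : AnisoBound s a → (Q : Fin s → QuadForm F N) → a < N →
                      DoubleNegation (Σ (Vector Carrier N) (NontrivialZero F Q))
  ¬¬-nontrivialZero bound Q a<N ¬zero = ℕₚ.<⇒≱ a<N (bound _ (Q , λ x x-zero → ¬zero (x , x-zero)))

  embed-·ₘ-solves : {cs : Fin e → Vector Carrier N} (S : SolutionSpace cs) (M : Matrix (dim S) d) →
                    ∀ r z → cs r · (embed S ·ₘ M ·ᵥ z) ≈ 0#
  embed-·ₘ-solves {cs = cs} S M r z =
    trans (·-congˡ (cs r) (·ₘ-·ᵥ-assoc (embed S) M z)) (embed-solves S r (M ·ᵥ z))

  pullback-totallyIsotropic : (Q : Fin s → QuadForm F N) (L : Matrix N k) {M : Matrix k d} →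
                              TotallyIsotropic (λ r → pullback (Q r) L) M → TotallyIsotropic Q (L ·ₘ M)
  pullback-totallyIsotropic Q L {M} M-iso r z = begin
    ⟦ Q r ⟧ (L ·ₘ M ·ᵥ z)         ≈⟨ ⟦⟧-cong (Q r) (·ₘ-·ᵥ-assoc L M z) ⟩
    ⟦ Q r ⟧ (L ·ᵥ (M ·ᵥ z))       ≈⟨ ⟦pullback⟧ (Q r) L (M ·ᵥ z) ⟨
    ⟦ pullback (Q r) L ⟧ (M ·ᵥ z) ≈⟨ M-iso r z ⟩
    0#                            ∎

  infixr 5 _∷ᶜ_

  _∷ᶜ_ : Vector Carrier N → Matrix N d → Matrix N (suc d)
  (v ∷ᶜ M) i = v i ∷ M i

  ∷ᶜ-·ᵥ : (v : Vector Carrier N) (M : Matrix N d) (z : Vector Carrier (suc d)) →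
          ∀ i → ((v ∷ᶜ M) ·ᵥ z) i ≈ z zero * v i + (M ·ᵥ (z ∘ suc)) i
  ∷ᶜ-·ᵥ v M z i = trans (reflexive (∑-suc _)) (+-congʳ (*-comm _ _))

  ∷ᶜ-totallyIsotropic : (Q : Fin s → QuadForm F N) {v : Vector Carrier N} {W : Matrix N d} →
                        (∀ r → ⟦ Q r ⟧ v ≈ 0#) → (∀ r z → polar (Q r) v · (W ·ᵥ z) ≈ 0#) →
                        TotallyIsotropic Q W → TotallyIsotropic Q (v ∷ᶜ W)
  ∷ᶜ-totallyIsotropic Q {v} {W} v-iso v⊥W W-iso r z = begin
    ⟦ Q r ⟧ ((v ∷ᶜ W) ·ᵥ z)                              ≈⟨ ⟦⟧-cong (Q r) (∷ᶜ-·ᵥ v W z) ⟩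
    ⟦ Q r ⟧ (λ i → t * v i + y i)                        ≈⟨ ⟦⟧-expand (Q r) t v y ⟩
    t * t * ⟦ Q r ⟧ v + t * (polar (Q r) v · y) + ⟦ Q r ⟧ y
      ≈⟨ +-cong (+-cong (*-congˡ (v-iso r)) (*-congˡ (v⊥W r (z ∘ suc)))) (W-iso r (z ∘ suc)) ⟩
    t * t * 0# + t * 0# + 0#                             ≈⟨ +-identityʳ _ ⟩
    t * t * 0# + t * 0#                                  ≈⟨ +-cong (zeroʳ _) (zeroʳ _) ⟩
    0# + 0#                                              ≈⟨ +-identityʳ _ ⟩
    0#                                                   ∎
    where
    t = z zero
    y = W ·ᵥ (z ∘ suc)

  ∷ᶜ-trivialKernel : {v : Vector Carrier N} {W : Matrix N d} {j : Fin N} → ¬ v j ≈ 0# →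
                     (∀ z → (W ·ᵥ z) j ≈ 0#) → TrivialKernel W → TrivialKernel (v ∷ᶜ W)
  ∷ᶜ-trivialKernel {v = v} {W} {j} vⱼ≉0 Wⱼ≈0 W-inj z vWz≈0 = λ
    { zero    → t≈0
    ; (suc k) → W-inj (z ∘ suc) Wz≈0 k
    }
    where
    t = z zero
    y = W ·ᵥ (z ∘ suc)

    t≈0 : t ≈ 0#
    t≈0 = x≉0∧x*y≈0⇒y≈0 vⱼ≉0 (begin
      v j * t           ≈⟨ *-comm _ _ ⟩
      t * v j           ≈⟨ +-identityʳ _ ⟨
      t * v j + 0#      ≈⟨ +-congˡ (Wⱼ≈0 (z ∘ suc)) ⟨
      t * v j + y j     ≈⟨ ∷ᶜ-·ᵥ v W z j ⟨
      ((v ∷ᶜ W) ·ᵥ z) j ≈⟨ vWz≈0 j ⟩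
      0#                ∎)

    Wz≈0 : IsZero y
    Wz≈0 i = begin
      y i               ≈⟨ +-identityˡ _ ⟨
      0# + y i          ≈⟨ +-congʳ (trans (*-congʳ t≈0) (zeroˡ _)) ⟨
      t * v i + y i     ≈⟨ ∷ᶜ-·ᵥ v W z i ⟨
      ((v ∷ᶜ W) ·ᵥ z) i ≈⟨ vWz≈0 i ⟩
      0#                ∎

  ¬¬-totallyIsotropicSubspace : AnisoBound s a → ∀ d (Q : Fin s → QuadForm F N) →
                                a ℕ.+ suc s ℕ.* d < N ℕ.+ suc s →
                                DoubleNegation (Σ (Matrix N d) λ M → TrivialKernel M × TotallyIsotropic Q M)
  ¬¬-totallyIsotropicSubspace bound zero Q _ =
    pure ((λ _ ()) , (λ _ _ ()) , λ r z → ⟦⟧-null (Q r) (λ i → reflexive (∑-empty _)))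
  ¬¬-totallyIsotropicSubspace {s} {a} {N} bound (suc d) Q room = do
    (v , v≉0 , v-iso) ← ¬¬-nontrivialZero bound Q a<N
    inj₂ (j , vⱼ≉0) ← ¬¬-IsZero⊎nonzero v
      where inj₁ v≈0 → contradiction v≈0 v≉0
    L ← ¬¬-solutionSpace (δ j ∷ λ r → polar (Q r) v)
    (M , M-inj , M-iso) ← ¬¬-totallyIsotropicSubspace bound d (λ r → pullback (Q r) (embed L))
                            (ℕₚ.<-≤-trans room′ (N≤dim+e L))
    pure ( v ∷ᶜ embed L ·ₘ M
         , ∷ᶜ-trivialKernel vⱼ≉0 (λ z → trans (sym (δ-· j _)) (embed-·ₘ-solves L M zero z))
                                 (·ₘ-trivialKernel (embed-injective L) M-inj)
         , ∷ᶜ-totallyIsotropic Q (λ r → trans (sym (evalQF≈⟦⟧ (Q r) v)) (v-iso r))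
                                 (embed-·ₘ-solves L M ∘ suc)
                                 (pullback-totallyIsotropic Q (embed L) M-iso) )
    where
    room′ : a ℕ.+ suc s ℕ.* d < N
    room′ = ℕₚ.+-cancelʳ-< (suc s) _ N (≡.subst (_< N ℕ.+ suc s) (+-*-suc a (suc s) d) room)

    a<N : a < N
    a<N = ℕₚ.≤-<-trans (ℕₚ.m≤m+n a _) room′

  evalQF-pullback : (q : QuadForm F n) (M : Matrix n k) (z : Vector Carrier k) →
                    evalQF F (pullback q M) z ≈ 0# → evalQF F q (M ·ᵥ z) ≈ 0#
  evalQF-pullback q M z qMz≈0 = begin
    evalQF F q (M ·ᵥ z)         ≈⟨ evalQF≈⟦⟧ q (M ·ᵥ z) ⟩
    ⟦ q ⟧ (M ·ᵥ z)              ≈⟨ ⟦pullback⟧ q M z ⟨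
    ⟦ pullback q M ⟧ z          ≈⟨ evalQF≈⟦⟧ (pullback q M) z ⟨
    evalQF F (pullback q M) z   ≈⟨ qMz≈0 ⟩
    0#                          ∎

  AnisoBound-+ : AnisoBound s a → AnisoBound p b → AnisoBound (s ℕ.+ p) (a ℕ.+ suc s ℕ.* b)
  AnisoBound-+ {s} {a} {p} {b} bound₁ bound₂ N (Q , Q-aniso) =
    decidable-stable (N ≤? a ℕ.+ suc s ℕ.* b) λ N≰ → ¬¬-commonZero (ℕₚ.≰⇒> N≰) (uncurry Q-aniso)
    where
    ¬¬-commonZero : a ℕ.+ suc s ℕ.* b < N → DoubleNegation (Σ (Vector Carrier N) (NontrivialZero F Q))
    ¬¬-commonZero N> = do
      (M , M-inj , M-iso) ← ¬¬-totallyIsotropicSubspace bound₁ (suc b) (Q ∘ (_↑ˡ p)) room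
      (z , z≉0 , z-iso) ← ¬¬-nontrivialZero bound₂ (λ r → pullback (Q (s ↑ʳ r)) M) (ℕₚ.n<1+n b)
      pure ( M ·ᵥ z
           , z≉0 ∘ M-inj z
           , ↑ˡ-↑ʳ-elim (λ i → trans (evalQF≈⟦⟧ _ _) (M-iso i z))
                        (λ j → evalQF-pullback (Q (s ↑ʳ j)) M z (z-iso j)) )
      where
      room : a ℕ.+ suc s ℕ.* suc b < N ℕ.+ suc s
      room = ≡.subst (_< N ℕ.+ suc s) (≡.sym (+-*-suc a (suc s) b)) (ℕₚ.+-monoˡ-< (suc s) N>)

  Aniso-⊕ : Aniso F s n → Aniso F p k → Aniso F (s ℕ.+ p) (n ℕ.+ k)
  Aniso-⊕ {s} {n} {p} {k} (Q , Q-aniso) (R , R-aniso) = Q⊕R , Q⊕R-aniso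
    where
    Q′ : Fin s → QuadForm F (n ℕ.+ k)
    Q′ i = pullback (Q i) (select (_↑ˡ k))

    R′ : Fin p → QuadForm F (n ℕ.+ k)
    R′ j = pullback (R j) (select (n ↑ʳ_))

    Q⊕R : Fin (s ℕ.+ p) → QuadForm F (n ℕ.+ k)
    Q⊕R = Q′ ++ R′

    Q⊕R-aniso : ∀ x → ¬ NontrivialZero F Q⊕R x
    Q⊕R-aniso x (x≉0 , x-iso) = ¬¬-left-zero λ left≈0 → ¬¬-right-zero λ right≈0 →
      x≉0 (↑ˡ-↑ʳ-elim (λ i → trans (sym (select-·ᵥ (_↑ˡ k) x i)) (left≈0 i))
                      (λ j → trans (sym (select-·ᵥ (n ↑ʳ_) x j)) (right≈0 j)))
      where
      ¬¬-left-zero : DoubleNegation (IsZero (select (_↑ˡ k) ·ᵥ x))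
      ¬¬-left-zero ¬zero = Q-aniso _ (¬zero , λ i → evalQF-pullback (Q i) _ x
        (≡.subst (λ q → evalQF F q x ≈ 0#) (lookup-++ˡ Q′ R′ i) (x-iso (i ↑ˡ p))))

      ¬¬-right-zero : DoubleNegation (IsZero (select (n ↑ʳ_) ·ᵥ x))
      ¬¬-right-zero ¬zero = R-aniso _ (¬zero , λ j → evalQF-pullback (R j) _ x
        (≡.subst (λ q → evalQF F q x ≈ 0#) (lookup-++ʳ Q′ R′ j) (x-iso (s ↑ʳ j))))

  Aniso-⊕-replicate : ∀ j {u t n} → Aniso F 1 u → Aniso F t n → Aniso F (j ℕ.+ t) (j ℕ.* u ℕ.+ n)
  Aniso-⊕-replicate zero    φ A = A
  Aniso-⊕-replicate (suc j) {u} {t} {n} φ A =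
    ≡.subst (Aniso F (suc j ℕ.+ t)) (≡.sym (ℕₚ.+-assoc u (j ℕ.* u) n))
            (Aniso-⊕ φ (Aniso-⊕-replicate j φ A))

  AnisoBound-≤ : ∀ {u m t} → Aniso F 1 u → AnisoBound m (m ℕ.* u) → t ≤ m → AnisoBound t (t ℕ.* u)
  AnisoBound-≤ {u} {m} {t} φ bound t≤m n A =
    ℕₚ.+-cancelˡ-≤ ((m ℕ.∸ t) ℕ.* u) n (t ℕ.* u) (ℕₚ.≤-trans (bound _ padded) (ℕₚ.≤-reflexive m*u≡))
    where
    padded : Aniso F m ((m ℕ.∸ t) ℕ.* u ℕ.+ n)
    padded = ≡.subst (λ s → Aniso F s ((m ℕ.∸ t) ℕ.* u ℕ.+ n)) (ℕₚ.m∸n+n≡m t≤m)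
                     (Aniso-⊕-replicate (m ℕ.∸ t) φ A)

    m*u≡ : m ℕ.* u ≡ (m ℕ.∸ t) ℕ.* u ℕ.+ t ℕ.* u
    m*u≡ = ≡.trans (≡.cong (ℕ._* u) (≡.sym (ℕₚ.m∸n+n≡m t≤m))) (ℕₚ.*-distribʳ-+ u (m ℕ.∸ t) t)

  IsU⇒AnisoBound : IsU F s (fin b) → AnisoBound s b
  IsU⇒AnisoBound isU zero    _ = z≤n
  IsU⇒AnisoBound isU (suc n) A = IsSup-upper isU (s≤s z≤n , A)

  IsU₁⇒¬¬Aniso : ∀ {u} → IsU F 1 (fin u) → DoubleNegation (Aniso F 1 u)
  IsU₁⇒¬¬Aniso {zero}  _   = pure ((λ _ _ _ → 0#) , λ x (x≉0 , _) → x≉0 λ ())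
  IsU₁⇒¬¬Aniso {suc u} isU = ¬¬-map proj₂ (IsSup-attained isU)

  AnisoBound-progression : ∀ {u m τ} → Aniso F 1 u → AnisoBound m (m ℕ.* u) → τ ≤ m →
                           ∀ k → AnisoBound (τ ℕ.+ m ℕ.* k) (progressionBound m u τ k)
  AnisoBound-progression {u} {m} {τ} φ bound τ≤m zero =
    ≡.subst (λ s → AnisoBound s (τ ℕ.* u)) (≡.sym (+-*-zero τ m)) (AnisoBound-≤ φ bound τ≤m)
  AnisoBound-progression {u} {m} {τ} φ bound τ≤m (suc k) =
    ≡.subst (λ s → AnisoBound s (progressionBound m u τ (suc k))) (≡.sym (+-*-suc τ m k))
            (AnisoBound-+ (AnisoBound-progression φ bound τ≤m k) bound)

  ≤progressionBound : ∀ {u m τ k} → IsU F 1 (fin u) → IsU F m (m ⊗ fin u) → τ ≤ m →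
                      Aniso F (τ ℕ.+ m ℕ.* k) n → n ≤ progressionBound m u τ k
  ≤progressionBound {n} {k = k} isU₁ isUₘ τ≤m A = decidable-stable (n ≤? _)
    (¬¬-map (λ φ → AnisoBound-progression φ (IsU⇒AnisoBound isUₘ) τ≤m k n A) (IsU₁⇒¬¬Aniso isU₁))

open import Data.Integer using (ℤ; +_; _+_; _-_; _*_) renaming (_≤_ to _≤ℤ_)
open import Data.Integer.Divisibility using (_∣_)
import Data.Integer as ℤ
import Data.Integer.Properties as ℤₚ

twiceBound : (m τ u t : ℤ) → ℤ
twiceBound m τ u t = (t * (t - m + + 2) + τ * (m - τ)) * u

module _ where
  open import Data.Integer.Solver using (module +-*-Solver)
  open +-*-Solver

  twiceBound-start : ∀ m τ u → + 2 * (τ * u) ≡ twiceBound m τ u τ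
  twiceBound-start = solve 3 (λ m τ u →
    con (+ 2) :* (τ :* u) := (τ :* (τ :- m :+ con (+ 2)) :+ τ :* (m :- τ)) :* u) ≡.refl

  twiceBound-step : ∀ m τ u t → twiceBound m τ u t + + 2 * ((+ 1 + t) * (m * u)) ≡ twiceBound m τ u (t + m)
  twiceBound-step = solve 4 (λ m τ u t →
    (t :* (t :- m :+ con (+ 2)) :+ τ :* (m :- τ)) :* u :+ con (+ 2) :* ((con (+ 1) :+ t) :* (m :* u)) :=
    ((t :+ m) :* ((t :+ m) :- m :+ con (+ 2)) :+ τ :* (m :- τ)) :* u) ≡.refl

twice-progressionBound : ∀ m u τ k →
  + 2 * + progressionBound m u τ k ≡ twiceBound (+ m) (+ τ) (+ u) (+ (τ ℕ.+ m ℕ.* k))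
twice-progressionBound m u τ zero = begin
  + 2 * + (τ ℕ.* u)                       ≡⟨ ≡.cong (+ 2 *_) (ℤₚ.pos-* τ u) ⟩
  + 2 * (+ τ * + u)                       ≡⟨ twiceBound-start (+ m) (+ τ) (+ u) ⟩
  twiceBound (+ m) (+ τ) (+ u) (+ τ)      ≡⟨ ≡.cong (twiceBound (+ m) (+ τ) (+ u) ∘ +_) (+-*-zero τ m) ⟨
  twiceBound (+ m) (+ τ) (+ u) (+ (τ ℕ.+ m ℕ.* zero)) ∎
  where open ≡.≡-Reasoning
twice-progressionBound m u τ (suc k) = begin
  + 2 * + (B ℕ.+ suc T ℕ.* (m ℕ.* u))  ≡⟨ ≡.cong (+ 2 *_) casts ⟩
  + 2 * (+ B + increment)              ≡⟨ ℤₚ.*-distribˡ-+ (+ 2) (+ B) increment ⟩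
  + 2 * + B + + 2 * increment          ≡⟨ ≡.cong (_+ + 2 * increment) (twice-progressionBound m u τ k) ⟩
  bound (+ T) + + 2 * increment        ≡⟨ twiceBound-step (+ m) (+ τ) (+ u) (+ T) ⟩
  bound (+ T + + m)                    ≡⟨ ≡.cong bound (ℤₚ.pos-+ T m) ⟨
  bound (+ (T ℕ.+ m))                  ≡⟨ ≡.cong (bound ∘ +_) (+-*-suc τ m k) ⟨
  bound (+ (τ ℕ.+ m ℕ.* suc k))        ∎
  where
  open ≡.≡-Reasoning
  B = progressionBound m u τ k
  T = τ ℕ.+ m ℕ.* k
  bound = twiceBound (+ m) (+ τ) (+ u)
  increment = (+ 1 + + T) * (+ m * + u)

  casts : + (B ℕ.+ suc T ℕ.* (m ℕ.* u)) ≡ + B + increment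
  casts = ≡.trans (ℤₚ.pos-+ B _) (≡.cong (_+_ (+ B))
            (≡.trans (ℤₚ.pos-* (suc T) (m ℕ.* u)) (≡.cong₂ _*_ (ℤₚ.pos-+ 1 T) (ℤₚ.pos-* m u))))

∣-progression : ∀ {m t τ} → 1 ≤ t → τ ≤ m → (+ m) ∣ ((+ t) - (+ τ)) → Σ ℕ λ k → t ≡ τ ℕ.+ m ℕ.* k
∣-progression {m} {t} {τ} 1≤t τ≤m m∣t-τ with τ ≤? t
... | yes τ≤t with ℕ∣.divides q t∸τ≡q*m ← ≡.subst (λ i → m ℕ∣.∣ ℤ.∣ i ∣)
                                               (≡.trans (ℤₚ.[+m]-[+n]≡m⊖n t τ) (ℤₚ.⊖-≥ τ≤t)) m∣t-τ =
  q , ≡.trans (≡.sym (ℕₚ.m+[n∸m]≡n τ≤t)) (≡.cong (τ ℕ.+_) (≡.trans t∸τ≡q*m (ℕₚ.*-comm q m)))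
... | no τ≰t = contradiction (ℕ∣.∣⇒≤ {{ℕ.>-nonZero (ℕₚ.m<n⇒0<n∸m t<τ)}} m∣τ-t) (ℕₚ.<⇒≱ τ-t<m)
  where
  t<τ : t < τ
  t<τ = ℕₚ.≰⇒> τ≰t

  m∣τ-t : m ℕ∣.∣ τ ℕ.∸ t
  m∣τ-t = ≡.subst (m ℕ∣.∣_) (≡.trans (≡.cong ℤ.∣_∣ (≡.trans (ℤₚ.[+m]-[+n]≡m⊖n t τ) (ℤₚ.⊖-< t<τ)))
                                     (ℤₚ.∣-i∣≡∣i∣ (+ (τ ℕ.∸ t)))) m∣t-τ

  τ-t<m : τ ℕ.∸ t < m
  τ-t<m = ℕₚ.<-≤-trans (ℕₚ.∸-monoʳ-< {o = 0} 1≤t (ℕₚ.<⇒≤ t<τ)) τ≤m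

theorem1 : {c ℓ : Level} (F : Field c ℓ) (m : ℕ) → 1 ≤ m →
    (u₁ : ℕ∞) → IsU F 1 u₁ → IsU F m (m ⊗ u₁) →
    (t τ : ℕ) → 1 ≤ t → 1 ≤ τ → τ ≤ m → (+ m) ∣ ((+ t) - (+ τ)) →
    (u : ℕ) → u₁ ≡ fin u →
    (n : ℕ) → 1 ≤ n → Aniso F t n →
    (+ 2) * (+ n) ≤ℤ ((+ t) * ((+ t) - (+ m) + (+ 2)) + (+ τ) * ((+ m) - (+ τ))) * (+ u)
theorem1 F m _ .(fin u) isU₁ isUₘ t τ 1≤t _ τ≤m m∣t-τ u ≡.refl n _ A
  with k , ≡.refl ← ∣-progression 1≤t τ≤m m∣t-τ =
  ≡.subst ((+ 2) * (+ n) ≤ℤ_) (twice-progressionBound m u τ k)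
          (ℤₚ.*-monoˡ-≤-nonNeg (+ 2) (ℤ.+≤+ (≤progressionBound F isU₁ isUₘ τ≤m A)))
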